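{- For every duplicative forest $\mathfrak{f}$, there exists $\mathfrak{g}\in\mathcal{L}$ such that $\mathrm{pr}(\mathfrak{f})=\mathrm{pr}(\mathfrak{g})$.
   Context: A duplicative forest is a finite word $\mathfrak{f}_1\cdots\mathfrak{f}_\ell$ of duplicative trees (empty word $\epsilon$ allowed); a duplicative tree is $\circ(\mathfrak{g})$ or $\bullet(\mathfrak{g})$ for a duplicative forest $\mathfrak{g}$. $\cdot$ is concatenation. $\mathfrak{f}\lessdot\mathfrak{f}'$ iff $\mathfrak{f}'$ is obtained from $\mathfrak{f}$ by replacing one subtree $\circ(\mathfrak{g})$ by $\bullet(\mathfrak{g}\cdot\mathfrak{g})$; $\ll$ is its reflexive transitive closure; $\mathcal{D}^*(\mathfrak{f}) := \{\mathfrak{f}' : \mathfrak{f}\ll\mathfrak{f}'\}$. The $d$-ladder is $\mathfrak{l}_0:=\epsilon$, $\mathfrak{l}_d:=\circ(\mathfrak{l}_{d-1})$ for $d\ge1$, and $\mathcal{L}:=\bigcup_{d\ge0}\mathcal{D}^*(\mathfrak{l}_d)$. The pruning map: $\mathrm{pr}(\mathfrak{f}_1\cdots\mathfrak{f}_\ell) := \mathrm{pr}(\mathfrak{f}_1)\cdots\mathrm{pr}(\mathfrak{f}_\ell)$, $\mathrm{pr}(\circ(\mathfrak{f})) := \circ(\mathrm{pr}(\mathfrak{f}))$, $\mathrm{pr}(\bullet(\mathfrak{f})) := \mathrm{pr}(\mathfrak{f})$. -}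

module Defs where

open import Data.Nat using (ℕ; zero; suc)
open import Data.List using (List; []; _∷_; _++_)
open import Data.Product using (∃; ∃-syntax; _×_; _,_)
open import Relation.Binary.Construct.Closure.ReflexiveTransitive using (Star)
open import Relation.Binary.PropositionalEquality using (_≡_)

mutual
  data Tree : Set where
    ∘ : Forest → Tree
    ● : Forest → Tree

  Forest : Set
  Forest = List Tree

-- Concatenation of forests is list append _++_ ; ε is [].

mutual
  data _⋖ᵗ_ : Tree → Tree → Set where
    here  : ∀ g → ∘ g ⋖ᵗ ● (g ++ g)
    in∘   : ∀ {g g'} → g ⋖ g' → ∘ g ⋖ᵗ ∘ g'
    in●   : ∀ {g g'} → g ⋖ g' → ● g ⋖ᵗ ● g'

  data _⋖_ : Forest → Forest → Set where
    head : ∀ {t t'} (fs : Forest) → t ⋖ᵗ t' → (t ∷ fs) ⋖ (t' ∷ fs)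
    tail : ∀ (t : Tree) {fs fs'} → fs ⋖ fs' → (t ∷ fs) ⋖ (t ∷ fs')

_≪_ : Forest → Forest → Set
_≪_ = Star _⋖_

D* : Forest → Forest → Set
D* f f' = f ≪ f'

ladder : ℕ → Forest
ladder zero    = []
ladder (suc d) = ∘ (ladder d) ∷ []

InL : Forest → Set
InL g = ∃[ d ] D* (ladder d) g

mutual
  prᵗ : Tree → Forest
  prᵗ (∘ f) = ∘ (pr f) ∷ []
  prᵗ (● f) = pr f

  pr : Forest → Forest
  pr []       = []
  pr (t ∷ fs) = prᵗ t ++ pr fs

{-# OPTIONS --safe #-}
module Submission where

-- Call a pruned forest p realizable at depth d when p = pr g for some g ∈ D*(l_d).
-- Realizability is closed under ∘-wrapping (depth d+1) and, since
-- l_{d+1} ⋖ •(l_d l_d), under concatenation at depth d+1. Every forest can be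
-- blackened completely, so ε is realizable at every depth; concatenating with it
-- shows that realizability is monotone in the depth, and the theorem follows
-- by induction on f.

open import Defs
open import Data.Nat using (ℕ; suc; _⊔_; _≤′_; ≤′-reflexive; ≤′-step)
open import Data.Nat.Properties using (m≤m⊔n; m≤n⊔m; ≤⇒≤′)
open import Data.List using ([]; _∷_; _++_; [_])
open import Data.List.Properties using (++-assoc; ++-identityʳ)
open import Data.Product using (∃-syntax; _×_; _,_)
open import Relation.Binary.PropositionalEquality using (_≡_; refl; sym; trans; cong; cong₂; subst)
open import Relation.Binary.Construct.Closure.ReflexiveTransitive using (ε; _◅_; _◅◅_; gmap)

pr-++ : (x y : Forest) → pr (x ++ y) ≡ pr x ++ pr y
pr-++ []      y = refl
pr-++ (t ∷ x) y = trans (cong (prᵗ t ++_) (pr-++ x y)) (sym (++-assoc (prᵗ t) (pr x) (pr y)))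

pr-● : (x : Forest) → pr [ ● x ] ≡ pr x
pr-● x = ++-identityʳ (pr x)

⋖-++ʳ : ∀ {x y} (z : Forest) → x ⋖ y → (x ++ z) ⋖ (y ++ z)
⋖-++ʳ z (head fs p) = head (fs ++ z) p
⋖-++ʳ z (tail t p)  = tail t (⋖-++ʳ z p)

⋖-++ˡ : ∀ {x y} (z : Forest) → x ⋖ y → (z ++ x) ⋖ (z ++ y)
⋖-++ˡ []      p = p
⋖-++ˡ (t ∷ z) p = tail t (⋖-++ˡ z p)

≪-++ : ∀ {x x' y y'} → x ≪ x' → y ≪ y' → (x ++ y) ≪ (x' ++ y')
≪-++ {x' = x'} {y = y} p q = gmap (_++ y) (⋖-++ʳ y) p ◅◅ gmap (x' ++_) (⋖-++ˡ x') q

≪-∘ : ∀ {x y} → x ≪ y → [ ∘ x ] ≪ [ ∘ y ]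
≪-∘ = gmap (λ x → [ ∘ x ]) (λ p → head [] (in∘ p))

≪-● : ∀ {x y} → x ≪ y → [ ● x ] ≪ [ ● y ]
≪-● = gmap (λ x → [ ● x ]) (λ p → head [] (in● p))

mutual
  ≪-pruned-empty : (x : Forest) → ∃[ x' ] (x ≪ x' × pr x' ≡ [])
  ≪-pruned-empty []      = [] , ε , refl
  ≪-pruned-empty (t ∷ x) with ≪-prunedᵗ-empty t | ≪-pruned-empty x
  ... | t' , t≪t' , e | x' , x≪x' , e' = t' ∷ x' , ≪-++ t≪t' x≪x' , cong₂ _++_ e e'

  ≪-prunedᵗ-empty : (t : Tree) → ∃[ t' ] ([ t ] ≪ [ t' ] × prᵗ t' ≡ [])
  ≪-prunedᵗ-empty (∘ x) with ≪-pruned-empty x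
  ... | x' , x≪x' , e =
    ● (x' ++ x') , ≪-∘ x≪x' ◅◅ (head [] (here x') ◅ ε) , trans (pr-++ x' x') (cong₂ _++_ e e)
  ≪-prunedᵗ-empty (● x) with ≪-pruned-empty x
  ... | x' , x≪x' , e = ● x' , ≪-● x≪x' , e

Realizable : ℕ → Forest → Set
Realizable d p = ∃[ g ] (ladder d ≪ g × pr g ≡ p)

realizable-∘ : ∀ {d p} → Realizable d p → Realizable (suc d) [ ∘ p ]
realizable-∘ (g , l≪g , e) = [ ∘ g ] , ≪-∘ l≪g , cong (λ q → [ ∘ q ]) e

realizable-++ : ∀ {d p q} → Realizable d p → Realizable d q → Realizable (suc d) (p ++ q)
realizable-++ {d} (g , l≪g , e) (h , l≪h , e') =
  ● (g ++ h) ∷ [] ,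
  head [] (here (ladder d)) ◅ ≪-● (≪-++ l≪g l≪h) ,
  trans (pr-● (g ++ h)) (trans (pr-++ g h) (cong₂ _++_ e e'))

realizable-[] : ∀ d → Realizable d []
realizable-[] d = ≪-pruned-empty (ladder d)

realizable-suc : ∀ {d p} → Realizable d p → Realizable (suc d) p
realizable-suc {d} {p} r =
  subst (Realizable (suc d)) (++-identityʳ p) (realizable-++ r (realizable-[] d))

realizable-mono : ∀ {d d' p} → d ≤′ d' → Realizable d p → Realizable d' p
realizable-mono (≤′-reflexive refl) r = r
realizable-mono (≤′-step d≤d')      r = realizable-suc (realizable-mono d≤d' r)

mutual
  pr-realizable : (f : Forest) → ∃[ d ] Realizable d (pr f)
  pr-realizable []      = 0 , realizable-[] 0
  pr-realizable (t ∷ f) with prᵗ-realizable t | pr-realizable f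
  ... | a , r | b , s =
    suc (a ⊔ b) , realizable-++ (realizable-mono (≤⇒≤′ (m≤m⊔n a b)) r)
                                (realizable-mono (≤⇒≤′ (m≤n⊔m a b)) s)

  prᵗ-realizable : (t : Tree) → ∃[ d ] Realizable d (prᵗ t)
  prᵗ-realizable (∘ f) with pr-realizable f
  ... | d , r = suc d , realizable-∘ r
  prᵗ-realizable (● f) = pr-realizable f

lemma2p2p4 : (f : Forest) → ∃[ g ] (InL g × pr f ≡ pr g)
lemma2p2p4 f with pr-realizable f
... | d , g , l≪g , e = g , (d , l≪g) , sym e
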